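{- Let $(S,\prec,\lhd)$ be a Burling set, let $R={\prec}\cup{\lhd}$, and let $R\lhd$ denote the relational composition: $x\,R\lhd\,z$ iff there is $y\in S$ with $x\,R\,y$ and $y\lhd z$. Consider a set of $2|S|$ distinct symbols $\ell_x,r_x$ ($x\in S$), and the binary relation $<$ on these symbols consisting exactly of the following pairs: (1) $\ell_x<r_x$ for all $x\in S$; (2) $\ell_x<\ell_y$ for all $x,y\in S$ with $y\,R\,x$; (3) $r_x<r_y$ for all $x,y\in S$ with $x\prec y$ or $y\lhd x$; (4) $r_x<\ell_y$ for all $x,y\in S$ with $y\,R\lhd\,x$. Then the relation $<$ is acyclic, i.e., there are no symbols $c_1,\dots,c_m$ ($m\ge1$) with $c_1<c_2<\cdots<c_m<c_1$.
   Context: A Burling set is a triple $(S,\prec,\lhd)$ where $S$ is a non-empty finite set, $\prec$ is a strict partial order on $S$, $\lhd$ is an acyclic relation on $S$ (no cycle $x_1\lhd\cdots\lhd x_m\lhd x_1$, $m\ge1$), and for all $x,y,z\in S$: (A1) if $x\prec y$, $x\prec z$, $y\ne z$, then $y\prec z$ or $z\prec y$; (A2) if $x\lhd y$, $x\lhd z$, $y\neq z$, then $y\prec z$ or $z\prec y$; (A3) if $x\lhd y$ and $x\prec z$, then $y\prec z$; (A4) if $x\lhd y$ and $y\prec z$, then $x\lhd z$ or $x\prec z$. -}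

module Defs where

open import Level using (0ℓ)
open import Data.Nat using (ℕ; suc)
open import Data.Fin using (Fin)
open import Data.Sum using (_⊎_; inj₁; inj₂)
open import Data.Product using (_×_; ∃-syntax)
open import Relation.Nullary using (¬_)
open import Relation.Binary using (Rel; IsStrictPartialOrder)
open import Relation.Binary.PropositionalEquality using (_≡_)
open import Relation.Binary.Construct.Closure.Transitive using (TransClosure)

Acyclic : {A : Set} → Rel A 0ℓ → Set
Acyclic {A} _~_ = ∀ (x : A) → ¬ TransClosure _~_ x x

record IsBurling {S : Set} (_≺_ : Rel S 0ℓ) (_◁_ : Rel S 0ℓ) : Set where
  field
    strictPO : IsStrictPartialOrder _≡_ _≺_
    acyc     : Acyclic _◁_
    A1 : ∀ {x y z} → x ≺ y → x ≺ z → ¬ (y ≡ z) → (y ≺ z) ⊎ (z ≺ y)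
    A2 : ∀ {x y z} → x ◁ y → x ◁ z → ¬ (y ≡ z) → (y ≺ z) ⊎ (z ≺ y)
    A3 : ∀ {x y z} → x ◁ y → x ≺ z → y ≺ z
    A4 : ∀ {x y z} → x ◁ y → y ≺ z → (x ◁ z) ⊎ (x ≺ z)

Rrel : {S : Set} → Rel S 0ℓ → Rel S 0ℓ → Rel S 0ℓ
Rrel _≺_ _◁_ x y = (x ≺ y) ⊎ (x ◁ y)

RComp◁ : {S : Set} → Rel S 0ℓ → Rel S 0ℓ → Rel S 0ℓ
RComp◁ _≺_ _◁_ x z = ∃[ y ] (Rrel _≺_ _◁_ x y × (y ◁ z))

-- Symbols: inj₁ x = ℓ_x, inj₂ x = r_x (2|S| distinct symbols).
Symbol : Set → Set
Symbol S = S ⊎ S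

data SymLt {S : Set} (_≺_ : Rel S 0ℓ) (_◁_ : Rel S 0ℓ) : Rel (Symbol S) 0ℓ where
  ℓ<r : ∀ x → SymLt _≺_ _◁_ (inj₁ x) (inj₂ x)
  ℓ<ℓ : ∀ x y → Rrel _≺_ _◁_ y x → SymLt _≺_ _◁_ (inj₁ x) (inj₁ y)
  r<r : ∀ x y → (x ≺ y) ⊎ (y ◁ x) → SymLt _≺_ _◁_ (inj₂ x) (inj₂ y)
  r<ℓ : ∀ x y → RComp◁ _≺_ _◁_ y x → SymLt _≺_ _◁_ (inj₂ x) (inj₁ y)

module Submission where

open import Defs
open import Level using (0ℓ)
open import Data.Nat using (ℕ; suc)
open import Data.Fin using (Fin; _≟_)
open import Data.Sum as ⊎ using (_⊎_; inj₁; inj₂)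
open import Data.Product using (_,_)
open import Relation.Nullary using (¬_; yes; no)
open import Relation.Binary using (Rel; IsStrictPartialOrder; DecidableEquality)
open import Relation.Binary.PropositionalEquality using (_≡_; refl)
open import Relation.Binary.Construct.Closure.Transitive using (TransClosure; [_]; _∷_; _∷ʳ_)

-- The transitive closure of < is contained in an explicit relation `Reach` on
-- symbols, described through ≺ and through "bridges" y ≼ b ◁⁺ a ≽ x.  `Reach`
-- contains every edge and is stable under prepending an edge (a case analysis
-- using A1, A3 and A4), and it is irreflexive: a ◁-chain never joins two
-- ≺-comparable elements, while two elements above a common one are comparable
-- by A1.

module BurlingSymbols {S : Set} (_≟ₛ_ : DecidableEquality S)
                      {_≺_ _◁_ : Rel S 0ℓ} (burling : IsBurling _≺_ _◁_) where

  open IsBurling burling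

  ≺-irrefl : ∀ {x} → ¬ (x ≺ x)
  ≺-irrefl = IsStrictPartialOrder.irrefl strictPO refl

  ≺-trans : ∀ {x y z} → x ≺ y → y ≺ z → x ≺ z
  ≺-trans = IsStrictPartialOrder.trans strictPO

  _≼_ : Rel S 0ℓ
  x ≼ y = (x ≡ y) ⊎ (x ≺ y)

  ≼-≺-trans : ∀ {x y z} → x ≼ y → y ≺ z → x ≺ z
  ≼-≺-trans (inj₁ refl) y≺z = y≺z
  ≼-≺-trans (inj₂ x≺y)  y≺z = ≺-trans x≺y y≺z

  ≺-≼-trans : ∀ {x y z} → x ≺ y → y ≼ z → x ≺ z
  ≺-≼-trans x≺y (inj₁ refl) = x≺y
  ≺-≼-trans x≺y (inj₂ y≺z)  = ≺-trans x≺y y≺z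

  A1-total : ∀ {x y z} → x ≺ y → x ≺ z → (y ≺ z) ⊎ (z ≼ y)
  A1-total {y = y} {z} x≺y x≺z with y ≟ₛ z
  ... | yes refl = inj₂ (inj₁ refl)
  ... | no y≢z   = ⊎.map₂ inj₂ (A1 x≺y x≺z y≢z)

  A1-total-≼ : ∀ {x y z} → x ≼ y → x ≺ z → (y ≺ z) ⊎ (z ≼ y)
  A1-total-≼ (inj₁ refl) x≺z = inj₁ x≺z
  A1-total-≼ (inj₂ x≺y)  x≺z = A1-total x≺y x≺z

  Comparable : Rel S 0ℓ
  Comparable x y = (x ≼ y) ⊎ (y ≺ x)

  ≼-common-lower⇒comparable : ∀ {x y z} → x ≼ y → x ≼ z → Comparable y z
  ≼-common-lower⇒comparable (inj₁ refl) x≼z = inj₁ x≼z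
  ≼-common-lower⇒comparable (inj₂ x≺y)  x≼z = ⊎.swap (A1-total-≼ x≼z x≺y)

  _◁⁺_ : Rel S 0ℓ
  _◁⁺_ = TransClosure _◁_

  A3⁺ : ∀ {x y z} → x ◁⁺ y → x ≺ z → y ≺ z
  A3⁺ [ x◁y ]       x≺z = A3 x◁y x≺z
  A3⁺ (x◁w ∷ w◁⁺y) x≺z = A3⁺ w◁⁺y (A3 x◁w x≺z)

  A4⁺ : ∀ {x y z} → x ◁⁺ y → y ≺ z → (x ◁⁺ z) ⊎ (x ≺ z)
  A4⁺ [ x◁y ]       y≺z = ⊎.map₁ [_] (A4 x◁y y≺z)
  A4⁺ (x◁w ∷ w◁⁺y) y≺z with A4⁺ w◁⁺y y≺z
  ... | inj₁ w◁⁺z = inj₁ (x◁w ∷ w◁⁺z)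
  ... | inj₂ w≺z  = ⊎.map₁ [_] (A4 x◁w w≺z)

  ◁⁺⇒incomparable : ∀ {x y} → x ◁⁺ y → ¬ Comparable x y
  ◁⁺⇒incomparable x◁⁺x (inj₁ (inj₁ refl)) = acyc _ x◁⁺x
  ◁⁺⇒incomparable x◁⁺y (inj₁ (inj₂ x≺y))  = ≺-irrefl (A3⁺ x◁⁺y x≺y)
  ◁⁺⇒incomparable x◁⁺y (inj₂ y≺x)         = ⊎.[ acyc _ , ≺-irrefl ] (A4⁺ x◁⁺y y≺x)

  record Bridge (x y : S) : Set where
    constructor bridge
    field
      {top bottom} : S
      x≼top        : x ≼ top
      chain        : bottom ◁⁺ top
      y≼bottom     : y ≼ bottom

  Bridge-irrefl : ∀ {x} → ¬ Bridge x x
  Bridge-irrefl (bridge x≼a b◁⁺a x≼b) =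
    ◁⁺⇒incomparable b◁⁺a (≼-common-lower⇒comparable x≼b x≼a)

  ◁⇒Bridge : ∀ {x y} → y ◁ x → Bridge x y
  ◁⇒Bridge y◁x = bridge (inj₁ refl) [ y◁x ] (inj₁ refl)

  Bridge-≼ : ∀ {x y z} → Bridge x z → y ≼ z → Bridge x y
  Bridge-≼ b (inj₁ refl) = b
  Bridge-≼ (bridge x≼a b◁⁺a z≼b) (inj₂ y≺z) = bridge x≼a b◁⁺a (inj₂ (≺-≼-trans y≺z z≼b))

  ≺-Bridge-trans : ∀ {x y z} → x ≺ z → Bridge z y → Bridge x y
  ≺-Bridge-trans x≺z (bridge z≼a b◁⁺a y≼b) = bridge (inj₂ (≺-≼-trans x≺z z≼a)) b◁⁺a y≼b

  ◁˘-Bridge-trans : ∀ {x y z} → z ◁ x → Bridge z y → Bridge x y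
  ◁˘-Bridge-trans z◁x (bridge (inj₁ refl) b◁⁺z y≼b) = bridge (inj₁ refl) (b◁⁺z ∷ʳ z◁x) y≼b
  ◁˘-Bridge-trans z◁x (bridge (inj₂ z≺a)  b◁⁺a y≼b) = bridge (inj₂ (A3 z◁x z≺a)) b◁⁺a y≼b

  RComp◁⇒Bridge : ∀ {x y} → RComp◁ _≺_ _◁_ y x → Bridge x y
  RComp◁⇒Bridge (w , inj₁ y≺w , w◁x) = Bridge-≼ (◁⇒Bridge w◁x) (inj₂ y≺w)
  RComp◁⇒Bridge (w , inj₂ y◁w , w◁x) = bridge (inj₁ refl) (y◁w ∷ [ w◁x ]) (inj₁ refl)

  Below : Rel S 0ℓ
  Below y x = (y ≺ x) ⊎ Bridge x y

  R⇒Below : ∀ {x y} → Rrel _≺_ _◁_ y x → Below y x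
  R⇒Below (inj₁ y≺x) = inj₁ y≺x
  R⇒Below (inj₂ y◁x) = inj₂ (◁⇒Bridge y◁x)

  -- Either the chain of the bridge climbs past x (A4⁺), or x sits below its top (A1).
  Bridge-≺-Below : ∀ {x y z} → Bridge z y → z ≺ x → Below y x
  Bridge-≺-Below (bridge z≼a b◁⁺a y≼b) z≺x with A1-total-≼ z≼a z≺x
  ... | inj₂ x≼a = inj₂ (bridge x≼a b◁⁺a y≼b)
  ... | inj₁ a≺x = ⊎.[ (λ b◁⁺x → inj₂ (bridge (inj₁ refl) b◁⁺x y≼b))
                   , (λ b≺x → inj₁ (≼-≺-trans y≼b b≺x)) ] (A4⁺ b◁⁺a a≺x)

  Below-R-trans : ∀ {x y z} → Below y z → Rrel _≺_ _◁_ z x → Below y x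
  Below-R-trans (inj₁ y≺z) (inj₁ z≺x) = inj₁ (≺-trans y≺z z≺x)
  Below-R-trans (inj₁ y≺z) (inj₂ z◁x) = inj₂ (Bridge-≼ (◁⇒Bridge z◁x) (inj₂ y≺z))
  Below-R-trans (inj₂ b)   (inj₁ z≺x) = Bridge-≺-Below b z≺x
  Below-R-trans (inj₂ b)   (inj₂ z◁x) = inj₂ (◁˘-Bridge-trans z◁x b)

  Below-RComp◁⇒Bridge : ∀ {x y z} → Below y z → RComp◁ _≺_ _◁_ z x → Bridge x y
  Below-RComp◁⇒Bridge y-below-z (w , z-R-w , w◁x) with Below-R-trans y-below-z z-R-w
  ... | inj₁ y≺w = Bridge-≼ (◁⇒Bridge w◁x) (inj₂ y≺w)
  ... | inj₂ b   = ◁˘-Bridge-trans w◁x b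

  pattern ℓ x = inj₁ x
  pattern r x = inj₂ x

  Reach : Rel (Symbol S) 0ℓ
  Reach (ℓ x) (ℓ y) = Below y x
  Reach (ℓ x) (r y) = (x ≼ y) ⊎ Below y x
  Reach (r x) (r y) = (x ≺ y) ⊎ Bridge x y
  Reach (r x) (ℓ y) = Bridge x y

  Reach-irrefl : ∀ s → ¬ Reach s s
  Reach-irrefl (ℓ x) = ⊎.[ ≺-irrefl , Bridge-irrefl ]
  Reach-irrefl (r x) = ⊎.[ ≺-irrefl , Bridge-irrefl ]

  _<_ : Rel (Symbol S) 0ℓ
  _<_ = SymLt _≺_ _◁_

  <⇒Reach : ∀ {s t} → s < t → Reach s t
  <⇒Reach (ℓ<r x)                  = inj₁ (inj₁ refl)
  <⇒Reach (ℓ<ℓ x y y-R-x)          = R⇒Below y-R-x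
  <⇒Reach (r<r x y (inj₁ x≺y))     = inj₁ x≺y
  <⇒Reach (r<r x y (inj₂ y◁x))     = inj₂ (◁⇒Bridge y◁x)
  <⇒Reach (r<ℓ x y y-RComp◁-x)     = RComp◁⇒Bridge y-RComp◁-x

  ℓ<ℓ-Reach-r : ∀ {x y z} → Rrel _≺_ _◁_ z x → (z ≼ y) ⊎ Below y z → (x ≼ y) ⊎ Below y x
  ℓ<ℓ-Reach-r z-R-x        (inj₁ (inj₁ refl)) = inj₂ (R⇒Below z-R-x)
  ℓ<ℓ-Reach-r (inj₁ z≺x)   (inj₁ (inj₂ z≺y))  with A1-total z≺x z≺y
  ... | inj₁ x≺y         = inj₁ (inj₂ x≺y)
  ... | inj₂ (inj₁ refl) = inj₁ (inj₁ refl)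
  ... | inj₂ (inj₂ y≺x)  = inj₂ (inj₁ y≺x)
  ℓ<ℓ-Reach-r (inj₂ z◁x)   (inj₁ (inj₂ z≺y))  = inj₁ (inj₂ (A3 z◁x z≺y))
  ℓ<ℓ-Reach-r z-R-x        (inj₂ y-below-z)   = inj₂ (Below-R-trans y-below-z z-R-x)

  r<ℓ-Reach-r : ∀ {x y z} → RComp◁ _≺_ _◁_ z x → (z ≼ y) ⊎ Below y z → (x ≺ y) ⊎ Bridge x y
  r<ℓ-Reach-r c                       (inj₁ (inj₁ refl)) = inj₂ (RComp◁⇒Bridge c)
  r<ℓ-Reach-r (w , inj₁ z≺w , w◁x)    (inj₁ (inj₂ z≺y))  with A1-total z≺w z≺y
  ... | inj₁ w≺y = inj₁ (A3 w◁x w≺y)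
  ... | inj₂ y≼w = inj₂ (Bridge-≼ (◁⇒Bridge w◁x) y≼w)
  r<ℓ-Reach-r (w , inj₂ z◁w , w◁x)    (inj₁ (inj₂ z≺y))  = inj₁ (A3 w◁x (A3 z◁w z≺y))
  r<ℓ-Reach-r c                       (inj₂ y-below-z)   = inj₂ (Below-RComp◁⇒Bridge y-below-z c)

  rr-Bridge-trans : ∀ {x y z} → (x ≺ z) ⊎ (z ◁ x) → Bridge z y → Bridge x y
  rr-Bridge-trans = ⊎.[ ≺-Bridge-trans , ◁˘-Bridge-trans ]

  rr-≺-trans : ∀ {x y z} → (x ≺ z) ⊎ (z ◁ x) → z ≺ y → x ≺ y
  rr-≺-trans = ⊎.[ ≺-trans , A3 ]

  <-Reach-trans : ∀ {s t u} → s < t → Reach t u → Reach s u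
  <-Reach-trans {u = ℓ y} (ℓ<r x)         b = inj₂ b
  <-Reach-trans {u = r y} (ℓ<r x)         p = ⊎.map inj₂ inj₂ p
  <-Reach-trans {u = ℓ y} (ℓ<ℓ x z z-R-x) p = Below-R-trans p z-R-x
  <-Reach-trans {u = r y} (ℓ<ℓ x z z-R-x) p = ℓ<ℓ-Reach-r z-R-x p
  <-Reach-trans {u = ℓ y} (r<r x z q)     b = rr-Bridge-trans q b
  <-Reach-trans {u = r y} (r<r x z q)     p = ⊎.map (rr-≺-trans q) (rr-Bridge-trans q) p
  <-Reach-trans {u = ℓ y} (r<ℓ x z c)     p = Below-RComp◁⇒Bridge p c
  <-Reach-trans {u = r y} (r<ℓ x z c)     p = r<ℓ-Reach-r c p

  <⁺⇒Reach : ∀ {s t} → TransClosure _<_ s t → Reach s t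
  <⁺⇒Reach [ s<t ]       = <⇒Reach s<t
  <⁺⇒Reach (s<u ∷ u<⁺t) = <-Reach-trans s<u (<⁺⇒Reach u<⁺t)

  <-acyclic : Acyclic _<_
  <-acyclic s s<⁺s = Reach-irrefl s (<⁺⇒Reach s<⁺s)

mainTheorem10 : (k : ℕ) (_≺_ _◁_ : Rel (Fin (suc k)) 0ℓ) →
    IsBurling _≺_ _◁_ → Acyclic (SymLt _≺_ _◁_)
mainTheorem10 k _≺_ _◁_ burling = BurlingSymbols.<-acyclic _≟_ burling
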